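{- Let $a,b$ be relatively prime positive integers, $n\ge1$, let $P$ be an $(a,b)$-Dyck path of size $n$ with step sequence $\mathbf{u}=(u_1,\dots,u_{an})$, let $w=\mu_b(\mathbf{u})$, for $i\in[1,b]$ let $\nu^i$ be the permutation given by $\nu^i_j=w_{(j-1)b+i}$ ($1\le j\le an$), and let $\xi^i=\mu_1^{ -1}(\nu^i)$. Let $\theta_h(P)=(p_1,\dots,p_b)$ be the horizontal strip decomposition of $P$. Then for every $i\in[1,b]$, $\xi^i$ is the step sequence of $p_i$.
   Context: An $(a,b)$-Dyck path of size $n$ is a lattice path from $(0,0)$ to $(bn,an)$ with unit steps $N=(0,1)$, $E=(1,0)$ never going below $y=ax/b$. Step sequence of a path with $A$ north steps: $(u_1,\dots,u_A)$, $u_k$ the $x$-coordinate of the $k$-th north step. Height sequence of a path with $B$ east steps: $(h_1,\dots,h_B)$, $h_k$ the $y$-coordinate of the $k$-th east step. Horizontal strip decomposition: if $P$ has height sequence $(h_1,\dots,h_{bn})$, then $p_i$ ($1\le i\le b$) is the lattice path from $(0,0)$ to $(n,an)$ with height sequence $(h_{(k-1)b+i})_{k=1}^n$. For a positive integer $c$, $\mu_c$ sends a sequence $(u_1,\dots,u_m)$ of nonnegative integers with $u_k\le c(k-1)$ to the word obtained by starting with $1^c$ and, for $k=2,\dots,m$, inserting the block $k^c$ immediately after the first $u_k$ letters of the current word. $\mu_1^{ -1}(w)=(\xi_1,\dots,\xi_m)$ for a permutation $w$ of $\{1,\dots,m\}$, where $\xi_k$ is the position of $k$ in the subword of $w$ formed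 by the letters $1,\dots,k$, minus one. -}

module Defs where

open import Data.Nat using (ℕ; zero; suc; _+_; _*_; _∸_; _≤_; _<_; _≤ᵇ_; _≡ᵇ_)
open import Data.Bool using (Bool; true; false; if_then_else_)
open import Data.List using (List; []; _∷_; _++_; map; take; drop; replicate; filter; upTo; inits; length)
open import Data.List.Relation.Unary.All using (All)
open import Data.Product using (_×_)
open import Relation.Binary.PropositionalEquality using (_≡_)
open import Data.Nat.Properties using (_≤?_)

data Step : Set where
  N E : Step

countN : List Step → ℕ
countN []      = 0
countN (N ∷ p) = suc (countN p)
countN (E ∷ p) = countN p

countE : List Step → ℕ
countE []      = 0
countE (N ∷ p) = countE p
countE (E ∷ p) = suc (countE p)

-- P (starting at (0,0)) is an (a,b)-Dyck path of size n: it ends at (bn, an)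
-- and every lattice point (x,y) it visits satisfies y ≥ a x / b, i.e. a x ≤ b y.
IsDyck : ℕ → ℕ → ℕ → List Step → Set
IsDyck a b n P =
  countE P ≡ b * n × countN P ≡ a * n ×
  All (λ q → a * countE q ≤ b * countN q) (inits P)

stepSeqFrom : ℕ → List Step → List ℕ
stepSeqFrom x []      = []
stepSeqFrom x (N ∷ p) = x ∷ stepSeqFrom x p
stepSeqFrom x (E ∷ p) = stepSeqFrom (suc x) p

stepSeq : List Step → List ℕ
stepSeq = stepSeqFrom 0

heightSeqFrom : ℕ → List Step → List ℕ
heightSeqFrom y []      = []
heightSeqFrom y (N ∷ p) = heightSeqFrom (suc y) p
heightSeqFrom y (E ∷ p) = y ∷ heightSeqFrom y p

heightSeq : List Step → List ℕ
heightSeq = heightSeqFrom 0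

-- The lattice path from (0,0) to (length hs, top) with height sequence hs
-- (hs is assumed weakly increasing and bounded by top): from current height
-- cur, go north up to height h, then east; finally go north up to top.
fromHeightsFrom : ℕ → ℕ → List ℕ → List Step
fromHeightsFrom top cur []       = replicate (top ∸ cur) N
fromHeightsFrom top cur (h ∷ hs) = replicate (h ∸ cur) N ++ (E ∷ fromHeightsFrom top h hs)

fromHeights : ℕ → List ℕ → List Step
fromHeights top = fromHeightsFrom top 0

-- 0-indexed list lookup with default 0.
nth : List ℕ → ℕ → ℕ
nth []       _       = 0
nth (x ∷ xs) zero    = x
nth (x ∷ xs) (suc k) = nth xs k

-- (v_{(j-1)b+i})_{j=1..len}, with 1-indexed i (here 0-indexed: v[j*b + (i-1)], j<len).
strided : ℕ → ℕ → List ℕ → ℕ → List ℕ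
strided b len v i = map (λ j → nth v (j * b + (i ∸ 1))) (upTo len)

-- Horizontal strip decomposition: i-th component p_i (1 ≤ i ≤ b) of θ_h(P)
-- for an (a,b)-Dyck path P of size n: the path from (0,0) to (n, an) with
-- height sequence (h_{(k-1)b+i})_{k=1..n}.
hStrip : ℕ → ℕ → ℕ → List Step → ℕ → List Step
hStrip a b n P i = fromHeights (a * n) (strided b n (heightSeq P) i)

thetaH : ℕ → ℕ → ℕ → List Step → List (List Step)
thetaH a b n P = map (λ i → hStrip a b n P (suc i)) (upTo b)

-- μ_c: start with 1^c; for k = 2..m insert k^c right after the first u_k letters.
muGo : ℕ → ℕ → List ℕ → List ℕ → List ℕ
muGo c k w []       = w
muGo c k w (u ∷ us) = muGo c (suc k) (take u w ++ replicate c k ++ drop u w) us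

mu : ℕ → List ℕ → List ℕ
mu c []       = []
mu c (_ ∷ us) = muGo c 2 (replicate c 1) us

indexOf : ℕ → List ℕ → ℕ
indexOf k []       = 0
indexOf k (x ∷ xs) = if x ≡ᵇ k then 0 else suc (indexOf k xs)

-- μ_1^{-1}(w) = (ξ_1,…,ξ_m), ξ_k = (position of k in subword of letters ≤ k) − 1.
muInv1 : List ℕ → List ℕ
muInv1 w = map (λ j → indexOf (suc j) (filter (λ x → x ≤? suc j) w)) (upTo (length w))

-- Write r = i − 1. In a word whose length is a multiple of b, inserting the block
-- k^b after the first u letters inserts exactly one k into column r (the letters
-- at positions j b + r), namely after its first ⌈(u − r)/b⌉ letters. Hence
-- ν^i = μ_1(ξ) with ξ_k = ⌈(u_k − r)/b⌉, and μ_1^{-1} undoes μ_1 because the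
-- letters ≤ k of μ_1(ξ) spell the word built after inserting k.
-- On the other side, the k-th north step of p_i has as x-coordinate the number of
-- t with h_{t b + r} ≤ k − 1, and h_m ≤ k − 1 holds iff the m-th east step of P
-- precedes its k-th north step, i.e. m < u_k; the t with t b + r < u_k are again
-- ⌈(u_k − r)/b⌉ many.

module Submission where

open import Data.Bool using (true; false)
open import Data.Bool.Properties using (T-≡)
open import Data.Empty using (⊥-elim)
open import Data.List using (List; []; _∷_; _++_; map; take; drop; replicate; filter; upTo; applyUpTo; length; inits)
open import Data.List.Properties using (++-identityʳ; length-++; length-map; length-upTo; length-replicate; take++drop≡id; map-applyUpTo; filter-++; filter-all; filter-none)
open import Data.List.Relation.Unary.All as All using (All; []; _∷_)
open import Data.List.Relation.Unary.All.Properties using (++⁺; take⁺; drop⁺; map⁻)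
open import Data.Nat
open import Data.Nat.Coprimality using (Coprime)
open import Data.Nat.DivMod using (_/_; m/n*n≤m; m*n/n≡m; /-monoˡ-≤)
open import Data.Nat.Properties
open import Algebra.Properties.CommutativeSemigroup +-commutativeSemigroup using (x∙yz≈y∙xz)
open import Data.Product using (_×_; _,_; proj₁; proj₂)
open import Data.Unit using (⊤; tt)
open import Function using (id; _∘_; _⇔_; mk⇔; Equivalence)
open import Relation.Binary using (tri<; tri≈; tri>)
open import Relation.Binary.PropositionalEquality
open import Relation.Nullary using (yes; no)
open import Relation.Unary using (Decidable; ∁)
open import Defs

open Equivalence using (to; from)

nth-ext : ∀ xs ys → length xs ≡ length ys → (∀ j → j < length xs → nth xs j ≡ nth ys j) → xs ≡ ys
nth-ext []       []       _  _  = refl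
nth-ext (x ∷ xs) (y ∷ ys) eq pw =
  cong₂ _∷_ (pw 0 z<s) (nth-ext xs ys (suc-injective eq) (λ j j< → pw (suc j) (s<s j<)))

nth-applyUpTo : ∀ (f : ℕ → ℕ) n j → j < n → nth (applyUpTo f n) j ≡ f j
nth-applyUpTo f (suc n) zero    _         = refl
nth-applyUpTo f (suc n) (suc j) (s<s j<n) = nth-applyUpTo (f ∘ suc) n j j<n

nth-map-upTo : ∀ (f : ℕ → ℕ) n j → j < n → nth (map f (upTo n)) j ≡ f j
nth-map-upTo f n j j<n = trans (cong (λ xs → nth xs j) (map-applyUpTo id f n)) (nth-applyUpTo f n j j<n)

length-map-upTo : ∀ (f : ℕ → ℕ) n → length (map f (upTo n)) ≡ n
length-map-upTo f n = trans (length-map f (upTo n)) (length-upTo n)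

nth-map : ∀ (f : ℕ → ℕ) xs j → j < length xs → nth (map f xs) j ≡ f (nth xs j)
nth-map f (x ∷ xs) zero    _        = refl
nth-map f (x ∷ xs) (suc j) (s<s j<) = nth-map f xs j j<

nth-replicate : ∀ n x j → j < n → nth (replicate n x) j ≡ x
nth-replicate (suc n) x zero    _         = refl
nth-replicate (suc n) x (suc j) (s<s j<n) = nth-replicate n x j j<n

nth-++ˡ : ∀ xs ys j → j < length xs → nth (xs ++ ys) j ≡ nth xs j
nth-++ˡ (x ∷ xs) ys zero    _        = refl
nth-++ˡ (x ∷ xs) ys (suc j) (s<s j<) = nth-++ˡ xs ys j j<

nth-++ʳ : ∀ xs ys j → length xs ≤ j → nth (xs ++ ys) j ≡ nth ys (j ∸ length xs)
nth-++ʳ []       ys j       _        = refl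
nth-++ʳ (x ∷ xs) ys (suc j) (s≤s ≤j) = nth-++ʳ xs ys j ≤j

insertAt : ℕ → List ℕ → List ℕ → List ℕ
insertAt u xs ws = take u ws ++ xs ++ drop u ws

length-insertAt : ∀ u xs ws → length (insertAt u xs ws) ≡ length xs + length ws
length-insertAt u xs ws = begin
  length (take u ws ++ xs ++ drop u ws)                 ≡⟨ length-++ (take u ws) ⟩
  length (take u ws) + length (xs ++ drop u ws)         ≡⟨ cong (length (take u ws) +_) (length-++ xs) ⟩
  length (take u ws) + (length xs + length (drop u ws)) ≡⟨ x∙yz≈y∙xz (length (take u ws)) (length xs) _ ⟩
  length xs + (length (take u ws) + length (drop u ws)) ≡⟨ cong (length xs +_) (length-++ (take u ws)) ⟨
  length xs + length (take u ws ++ drop u ws)           ≡⟨ cong (λ zs → length xs + length zs) (take++drop≡id u ws) ⟩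
  length xs + length ws                                 ∎
  where open ≡-Reasoning

nth-insertAt-before : ∀ u xs ws j → u ≤ length ws → j < u → nth (insertAt u xs ws) j ≡ nth ws j
nth-insertAt-before (suc u) xs (w ∷ ws) zero    _        _         = refl
nth-insertAt-before (suc u) xs (w ∷ ws) (suc j) (s≤s u≤) (s<s j<u) = nth-insertAt-before u xs ws j u≤ j<u

nth-insertAt-inside : ∀ u xs ws j → u ≤ length ws → u ≤ j → j < u + length xs →
  nth (insertAt u xs ws) j ≡ nth xs (j ∸ u)
nth-insertAt-inside zero    xs ws       j       _        _        j<  = nth-++ˡ xs ws j j<
nth-insertAt-inside (suc u) xs (w ∷ ws) (suc j) (s≤s u≤) (s≤s u≤j) (s<s j<) = nth-insertAt-inside u xs ws j u≤ u≤j j<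

nth-insertAt-after : ∀ u xs ws j → u ≤ length ws → u + length xs ≤ j →
  nth (insertAt u xs ws) j ≡ nth ws (j ∸ length xs)
nth-insertAt-after zero    xs ws       j       _        ≤j       = nth-++ʳ xs ws j ≤j
nth-insertAt-after (suc u) xs (w ∷ ws) (suc j) (s≤s u≤) (s≤s ≤j) = begin
  nth (insertAt u xs ws) j      ≡⟨ nth-insertAt-after u xs ws j u≤ ≤j ⟩
  nth ws (j ∸ length xs)        ≡⟨⟩
  nth (w ∷ ws) (suc (j ∸ length xs)) ≡⟨ cong (nth (w ∷ ws)) (+-∸-assoc 1 (≤-trans (m≤n+m (length xs) u) ≤j)) ⟨
  nth (w ∷ ws) (suc j ∸ length xs) ∎
  where open ≡-Reasoning

-- Every insertion position is in range when μ_c resumes with K blocks placed;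
-- `Admissible c 0 us` is the paper's condition u_k ≤ c (k − 1).
Admissible : ℕ → ℕ → List ℕ → Set
Admissible c K []       = ⊤
Admissible c K (u ∷ us) = u ≤ c * K × Admissible c (suc K) us

filter-insertAt-none : ∀ {P : ℕ → Set} (P? : Decidable P) u xs ws → All (∁ P) xs →
  filter P? (insertAt u xs ws) ≡ filter P? ws
filter-insertAt-none P? u xs ws none = begin
  filter P? (take u ws ++ xs ++ drop u ws)                      ≡⟨ filter-++ P? (take u ws) _ ⟩
  filter P? (take u ws) ++ filter P? (xs ++ drop u ws)          ≡⟨ cong (filter P? (take u ws) ++_) (filter-++ P? xs _) ⟩
  filter P? (take u ws) ++ filter P? xs ++ filter P? (drop u ws) ≡⟨ cong (λ ys → filter P? (take u ws) ++ ys ++ _) (filter-none P? none) ⟩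
  filter P? (take u ws) ++ filter P? (drop u ws)                ≡⟨ filter-++ P? (take u ws) _ ⟨
  filter P? (take u ws ++ drop u ws)                            ≡⟨ cong (filter P?) (take++drop≡id u ws) ⟩
  filter P? ws                                                  ∎
  where open ≡-Reasoning

filter-muGo₁ : ∀ {l} k ws ξs → l < k → filter (_≤? l) (muGo 1 k ws ξs) ≡ filter (_≤? l) ws
filter-muGo₁     k ws []       _   = refl
filter-muGo₁ {l} k ws (ξ ∷ ξs) l<k =
  trans (filter-muGo₁ (suc k) (insertAt ξ (k ∷ []) ws) ξs (m<n⇒m<1+n l<k))
        (filter-insertAt-none (_≤? l) ξ (k ∷ []) ws (<⇒≱ l<k ∷ []))

all-≤-insertAt : ∀ K u ws → All (_≤ K) ws → All (_≤ suc K) (insertAt u (suc K ∷ []) ws)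
all-≤-insertAt K u ws all≤ = ++⁺ (take⁺ u all≤′) (≤-refl ∷ drop⁺ u all≤′)
  where all≤′ = All.map m≤n⇒m≤1+n all≤

indexOf-here : ∀ k xs → indexOf k (k ∷ xs) ≡ 0
indexOf-here k xs rewrite to T-≡ (≡⇒≡ᵇ k k refl) = refl

indexOf-there : ∀ {k x} xs → x ≢ k → indexOf k (x ∷ xs) ≡ suc (indexOf k xs)
indexOf-there {k} {x} xs x≢k with x ≡ᵇ k in eq
... | true  = ⊥-elim (x≢k (≡ᵇ⇒≡ x k (from T-≡ eq)))
... | false = refl

indexOf-insertAt : ∀ k u ws → u ≤ length ws → All (_≢ k) ws → indexOf k (insertAt u (k ∷ []) ws) ≡ u
indexOf-insertAt k zero    ws       _        _              = indexOf-here k ws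
indexOf-insertAt k (suc u) (w ∷ ws) (s≤s u≤) (w≢k ∷ ≢k) =
  trans (indexOf-there (insertAt u (k ∷ []) ws) w≢k) (cong suc (indexOf-insertAt k u ws u≤ ≢k))

-- The letters ≤ K + j + 1 of the final word form the word of the stage at which
-- K + j + 1 was inserted.
indexOf-muGo₁ : ∀ K ws ξs → length ws ≡ K → All (_≤ K) ws → Admissible 1 K ξs → ∀ j → j < length ξs →
  indexOf (suc (K + j)) (filter (_≤? suc (K + j)) (muGo 1 (suc K) ws ξs)) ≡ nth ξs j
indexOf-muGo₁ K ws (ξ ∷ ξs) len all≤ (ξ≤ , adm) zero _ rewrite +-identityʳ K = begin
  indexOf (suc K) (filter (_≤? suc K) (muGo 1 (suc (suc K)) ws' ξs)) ≡⟨ cong (indexOf (suc K)) (filter-muGo₁ _ ws' ξs ≤-refl) ⟩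
  indexOf (suc K) (filter (_≤? suc K) ws')                          ≡⟨ cong (indexOf (suc K)) (filter-all (_≤? suc K) (all-≤-insertAt K ξ ws all≤)) ⟩
  indexOf (suc K) ws'                                               ≡⟨ indexOf-insertAt (suc K) ξ ws ξ≤len (All.map (λ ≤K → <⇒≢ (s≤s ≤K)) all≤) ⟩
  ξ                                                                 ∎
  where
  open ≡-Reasoning
  ws' = insertAt ξ (suc K ∷ []) ws
  ξ≤len : ξ ≤ length ws
  ξ≤len = ≤-trans ξ≤ (≤-reflexive (sym len))
indexOf-muGo₁ K ws (ξ ∷ ξs) len all≤ (_ , adm) (suc j) (s<s j<) rewrite +-suc K j =
  indexOf-muGo₁ (suc K) (insertAt ξ (suc K ∷ []) ws) ξs len' (all-≤-insertAt K ξ ws all≤) adm j j<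
  where
  len' : length (insertAt ξ (suc K ∷ []) ws) ≡ suc K
  len' = trans (length-insertAt ξ (suc K ∷ []) ws) (cong suc len)

length-muGo₁ : ∀ k ws ξs → length (muGo 1 k ws ξs) ≡ length ws + length ξs
length-muGo₁ k ws []       = sym (+-identityʳ (length ws))
length-muGo₁ k ws (ξ ∷ ξs) = begin
  length (muGo 1 (suc k) ws' ξs)  ≡⟨ length-muGo₁ (suc k) ws' ξs ⟩
  length ws' + length ξs          ≡⟨ cong (_+ length ξs) (length-insertAt ξ (k ∷ []) ws) ⟩
  suc (length ws) + length ξs     ≡⟨ +-suc (length ws) (length ξs) ⟨
  length ws + suc (length ξs)     ∎
  where
  open ≡-Reasoning
  ws' = insertAt ξ (k ∷ []) ws

muInv1-muGo₁ : ∀ ξs → Admissible 1 0 ξs → muInv1 (muGo 1 1 [] ξs) ≡ ξs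
muInv1-muGo₁ ξs adm = nth-ext _ _ same-length pointwise
  where
  w = muGo 1 1 [] ξs
  same-length : length (muInv1 w) ≡ length ξs
  same-length = trans (length-map-upTo _ (length w)) (length-muGo₁ 1 [] ξs)
  pointwise : ∀ j → j < length (muInv1 w) → nth (muInv1 w) j ≡ nth ξs j
  pointwise j j< = trans (nth-map-upTo _ (length w) j (subst (j <_) (length-map-upTo _ (length w)) j<))
                         (indexOf-muGo₁ 0 [] ξs refl [] adm j (subst (j <_) same-length j<))

-- An admissible sequence starts with 0, and μ_1 then amounts to running the
-- insertions from the empty word.
muInv1-mu₁ : ∀ ξs → Admissible 1 0 ξs → muInv1 (mu 1 ξs) ≡ ξs
muInv1-mu₁ []       _               = refl
muInv1-mu₁ (_ ∷ ξs) adm@(z≤n , _) = muInv1-muGo₁ (0 ∷ ξs) adm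

length-stepSeqFrom : ∀ x Q → length (stepSeqFrom x Q) ≡ countN Q
length-stepSeqFrom x []      = refl
length-stepSeqFrom x (N ∷ Q) = cong suc (length-stepSeqFrom x Q)
length-stepSeqFrom x (E ∷ Q) = length-stepSeqFrom (suc x) Q

stepSeqFrom-≥ : ∀ x Q j → j < countN Q → x ≤ nth (stepSeqFrom x Q) j
stepSeqFrom-≥ x (N ∷ Q) zero    _        = ≤-refl
stepSeqFrom-≥ x (N ∷ Q) (suc j) (s<s j<) = stepSeqFrom-≥ x Q j j<
stepSeqFrom-≥ x (E ∷ Q) j       j<       = <⇒≤ (stepSeqFrom-≥ (suc x) Q j j<)

stepSeqFrom-≤ : ∀ x Q j → j < countN Q → nth (stepSeqFrom x Q) j ≤ x + countE Q
stepSeqFrom-≤ x (N ∷ Q) zero    _        = m≤m+n x (countE Q)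
stepSeqFrom-≤ x (N ∷ Q) (suc j) (s<s j<) = stepSeqFrom-≤ x Q j j<
stepSeqFrom-≤ x (E ∷ Q) j       j<       = ≤-trans (stepSeqFrom-≤ (suc x) Q j j<) (≤-reflexive (sym (+-suc x (countE Q))))

heightSeqFrom-≥ : ∀ y Q m → m < countE Q → y ≤ nth (heightSeqFrom y Q) m
heightSeqFrom-≥ y (N ∷ Q) m       m<       = <⇒≤ (heightSeqFrom-≥ (suc y) Q m m<)
heightSeqFrom-≥ y (E ∷ Q) zero    _        = ≤-refl
heightSeqFrom-≥ y (E ∷ Q) (suc m) (s<s m<) = heightSeqFrom-≥ y Q m m<

heightSeqFrom-≤ : ∀ y Q m → m < countE Q → nth (heightSeqFrom y Q) m ≤ y + countN Q
heightSeqFrom-≤ y (N ∷ Q) m       m<       = ≤-trans (heightSeqFrom-≤ (suc y) Q m m<) (≤-reflexive (sym (+-suc y (countN Q))))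
heightSeqFrom-≤ y (E ∷ Q) zero    _        = m≤m+n y (countN Q)
heightSeqFrom-≤ y (E ∷ Q) (suc m) (s<s m<) = heightSeqFrom-≤ y Q m m<

heightSeqFrom-mono : ∀ y Q {m m′} → m ≤ m′ → m′ < countE Q → nth (heightSeqFrom y Q) m ≤ nth (heightSeqFrom y Q) m′
heightSeqFrom-mono y (N ∷ Q)             m≤       m′<       = heightSeqFrom-mono (suc y) Q m≤ m′<
heightSeqFrom-mono y (E ∷ Q) {zero}  {zero}   _        _         = ≤-refl
heightSeqFrom-mono y (E ∷ Q) {zero}  {suc m′} _        (s<s m′<) = heightSeqFrom-≥ y Q m′ m′<
heightSeqFrom-mono y (E ∷ Q) {suc m} {suc m′} (s≤s m≤) (s<s m′<) = heightSeqFrom-mono y Q m≤ m′<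

-- Both sides say that the m-th east step comes before the j-th north step.
heightSeq-≤⇔-stepSeq-> : ∀ x y Q m j → m < countE Q → j < countN Q →
  nth (heightSeqFrom y Q) m ≤ y + j ⇔ x + m < nth (stepSeqFrom x Q) j
heightSeq-≤⇔-stepSeq-> x y (N ∷ Q) m zero m< _ = mk⇔
  (λ h≤y → ⊥-elim (<⇒≱ (≤-trans (s≤s (≤-reflexive (+-identityʳ y))) (heightSeqFrom-≥ (suc y) Q m m<)) h≤y))
  (λ x+m<x → ⊥-elim (<⇒≱ x+m<x (m≤m+n x m)))
heightSeq-≤⇔-stepSeq-> x y (N ∷ Q) m (suc j) m< (s<s j<) =
  subst (λ z → nth (heightSeqFrom (suc y) Q) m ≤ z ⇔ x + m < nth (stepSeqFrom x Q) j) (sym (+-suc y j))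
    (heightSeq-≤⇔-stepSeq-> x (suc y) Q m j m< j<)
heightSeq-≤⇔-stepSeq-> x y (E ∷ Q) zero j _ j< = mk⇔
  (λ _ → subst (_< nth (stepSeqFrom (suc x) Q) j) (sym (+-identityʳ x)) (stepSeqFrom-≥ (suc x) Q j j<))
  (λ _ → m≤m+n y j)
heightSeq-≤⇔-stepSeq-> x y (E ∷ Q) (suc m) j (s<s m<) j< =
  subst (λ z → nth (heightSeqFrom y Q) m ≤ y + j ⇔ z < nth (stepSeqFrom (suc x) Q) j) (sym (+-suc x m))
    (heightSeq-≤⇔-stepSeq-> (suc x) y Q m j m< j<)

admissible-stepSeqFrom : ∀ (a b : ℕ) .{{_ : NonZero a}} x y Q →
  All (λ q → a * (x + countE q) ≤ b * (y + countN q)) (inits Q) → Admissible b y (stepSeqFrom x Q)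
admissible-stepSeqFrom a b x y []      _ = tt
admissible-stepSeqFrom a b x y (N ∷ Q) (here ∷ later) = x≤b*y , admissible-stepSeqFrom a b x (suc y) Q shifted
  where
  x≤b*y : x ≤ b * y
  x≤b*y = begin
    x            ≤⟨ m≤n*m x a ⟩
    a * x        ≡⟨ cong (a *_) (+-identityʳ x) ⟨
    a * (x + 0)  ≤⟨ here ⟩
    b * (y + 0)  ≡⟨ cong (b *_) (+-identityʳ y) ⟩
    b * y        ∎
    where open ≤-Reasoning
  later′ : All (λ q → a * (x + countE q) ≤ b * (y + countN q)) (map (N ∷_) (inits Q))
  later′ = later
  shifted : All (λ q → a * (x + countE q) ≤ b * (suc y + countN q)) (inits Q)
  shifted = All.map (λ {q} ≤b → subst (λ z → a * (x + countE q) ≤ b * z) (+-suc y (countN q)) ≤b) (map⁻ later′)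
admissible-stepSeqFrom a b x y (E ∷ Q) (_ ∷ later) = admissible-stepSeqFrom a b (suc x) y Q shifted
  where
  later′ : All (λ q → a * (x + countE q) ≤ b * (y + countN q)) (map (E ∷_) (inits Q))
  later′ = later
  shifted : All (λ q → a * (suc x + countE q) ≤ b * (y + countN q)) (inits Q)
  shifted = All.map (λ {q} ≤b → subst (λ z → a * z ≤ b * (y + countN q)) (+-suc x (countE q)) ≤b) (map⁻ later′)

countN-replicateN-++ : ∀ d Q → countN (replicate d N ++ Q) ≡ d + countN Q
countN-replicateN-++ zero    Q = refl
countN-replicateN-++ (suc d) Q = cong suc (countN-replicateN-++ d Q)

stepSeqFrom-replicateN-++ : ∀ x d Q → stepSeqFrom x (replicate d N ++ Q) ≡ replicate d x ++ stepSeqFrom x Q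
stepSeqFrom-replicateN-++ x zero    Q = refl
stepSeqFrom-replicateN-++ x (suc d) Q = cong (x ∷_) (stepSeqFrom-replicateN-++ x d Q)

∸-telescope : ∀ {l m n} → l ≤ m → m ≤ n → (m ∸ l) + (n ∸ m) ≡ n ∸ l
∸-telescope {l} {m} {n} l≤m m≤n = begin
  (m ∸ l) + (n ∸ m)  ≡⟨ +-comm (m ∸ l) (n ∸ m) ⟩
  (n ∸ m) + (m ∸ l)  ≡⟨ +-∸-assoc (n ∸ m) l≤m ⟨
  (n ∸ m) + m ∸ l    ≡⟨ cong (_∸ l) (m∸n+n≡m m≤n) ⟩
  n ∸ l              ∎
  where open ≡-Reasoning

NonDecreasing : List ℕ → Set
NonDecreasing hs = ∀ {m m′} → m ≤ m′ → m′ < length hs → nth hs m ≤ nth hs m′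

HeightsBetween : ℕ → ℕ → List ℕ → Set
HeightsBetween lo hi hs = NonDecreasing hs × (∀ t → t < length hs → lo ≤ nth hs t × nth hs t ≤ hi)

module _ {lo hi h : ℕ} {hs : List ℕ} (between : HeightsBetween lo hi (h ∷ hs)) where

  heightsBetween-head : lo ≤ h × h ≤ hi
  heightsBetween-head = proj₂ between 0 z<s

  heightsBetween-tail : HeightsBetween h hi hs
  heightsBetween-tail =
    (λ m≤ m′< → proj₁ between (s≤s m≤) (s<s m′<)) ,
    (λ t t< → proj₁ between z≤n (s<s t<) , proj₂ (proj₂ between (suc t) (s<s t<)))

countN-fromHeightsFrom : ∀ top cur hs → HeightsBetween cur top hs → countN (fromHeightsFrom top cur hs) ≡ top ∸ cur
countN-fromHeightsFrom top cur []       _       = begin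
  countN (replicate (top ∸ cur) N)        ≡⟨ cong countN (++-identityʳ (replicate (top ∸ cur) N)) ⟨
  countN (replicate (top ∸ cur) N ++ [])  ≡⟨ countN-replicateN-++ (top ∸ cur) [] ⟩
  top ∸ cur + 0                           ≡⟨ +-identityʳ (top ∸ cur) ⟩
  top ∸ cur                               ∎
  where open ≡-Reasoning
countN-fromHeightsFrom top cur (h ∷ hs) between = begin
  countN (replicate (h ∸ cur) N ++ E ∷ fromHeightsFrom top h hs)  ≡⟨ countN-replicateN-++ (h ∸ cur) _ ⟩
  (h ∸ cur) + countN (fromHeightsFrom top h hs)                  ≡⟨ cong ((h ∸ cur) +_) (countN-fromHeightsFrom top h hs (heightsBetween-tail between)) ⟩
  (h ∸ cur) + (top ∸ h)                                           ≡⟨ ∸-telescope (proj₁ (heightsBetween-head between)) (proj₂ (heightsBetween-head between)) ⟩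
  top ∸ cur                                                       ∎
  where open ≡-Reasoning

nth-replicate-++ˡ : ∀ d x ys j → j < d → nth (replicate d x ++ ys) j ≡ x
nth-replicate-++ˡ (suc d) x ys zero    _         = refl
nth-replicate-++ˡ (suc d) x ys (suc j) (s<s j<d) = nth-replicate-++ˡ d x ys j j<d

nth-replicate-++ʳ : ∀ d x ys j → d ≤ j → nth (replicate d x ++ ys) j ≡ nth ys (j ∸ d)
nth-replicate-++ʳ zero    x ys j       _        = refl
nth-replicate-++ʳ (suc d) x ys (suc j) (s≤s d≤j) = nth-replicate-++ʳ d x ys j d≤j

-- The hypothesis says that the heights ≤ cur + j are exactly the first c ones:
-- the east steps made before the j-th north step.
nth-stepSeq-fromHeightsFrom : ∀ top cur x hs j c → HeightsBetween cur top hs → j < top ∸ cur → c ≤ length hs →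
  (∀ t → t < length hs → nth hs t ≤ cur + j ⇔ t < c) →
  nth (stepSeqFrom x (fromHeightsFrom top cur hs)) j ≡ x + c
nth-stepSeq-fromHeightsFrom top cur x [] j zero _ j< _ _ = begin
  nth (stepSeqFrom x (replicate (top ∸ cur) N)) j        ≡⟨ cong (λ Q → nth (stepSeqFrom x Q) j) (++-identityʳ (replicate (top ∸ cur) N)) ⟨
  nth (stepSeqFrom x (replicate (top ∸ cur) N ++ [])) j  ≡⟨ cong (λ xs → nth xs j) (stepSeqFrom-replicateN-++ x (top ∸ cur) []) ⟩
  nth (replicate (top ∸ cur) x ++ []) j                  ≡⟨ nth-replicate-++ˡ (top ∸ cur) x [] j j< ⟩
  x                                                      ≡⟨ +-identityʳ x ⟨
  x + 0                                                  ∎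
  where open ≡-Reasoning
nth-stepSeq-fromHeightsFrom top cur x (h ∷ hs) j c between j< c≤ below⇔
  rewrite stepSeqFrom-replicateN-++ x (h ∸ cur) (E ∷ fromHeightsFrom top h hs)
  with j <? h ∸ cur | c
... | yes j<d | zero   = trans (nth-replicate-++ˡ (h ∸ cur) x _ j j<d) (sym (+-identityʳ x))
... | yes j<d | suc _  = ⊥-elim (<⇒≱ cur+j<h (from (below⇔ 0 z<s) z<s))
  where
  cur+j<h : cur + j < h
  cur+j<h = <-≤-trans (+-monoʳ-< cur j<d) (≤-reflexive (m+[n∸m]≡n (proj₁ (heightsBetween-head between))))
... | no j≮d | zero   = ⊥-elim (<-irrefl refl (to (below⇔ 0 z<s) h≤cur+j))
  where
  h≤cur+j : h ≤ cur + j
  h≤cur+j = ≤-trans (≤-reflexive (sym (m+[n∸m]≡n (proj₁ (heightsBetween-head between))))) (+-monoʳ-≤ cur (≮⇒≥ j≮d))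
... | no j≮d | suc c′ = begin
  nth (replicate (h ∸ cur) x ++ stepSeqFrom (suc x) (fromHeightsFrom top h hs)) j
    ≡⟨ nth-replicate-++ʳ (h ∸ cur) x _ j (≮⇒≥ j≮d) ⟩
  nth (stepSeqFrom (suc x) (fromHeightsFrom top h hs)) (j ∸ (h ∸ cur))
    ≡⟨ nth-stepSeq-fromHeightsFrom top h (suc x) hs _ c′ (heightsBetween-tail between) j′< (s≤s⁻¹ c≤) below⇔′ ⟩
  suc x + c′
    ≡⟨ +-suc x c′ ⟨
  x + suc c′
    ∎
  where
  open ≡-Reasoning
  cur≤h = proj₁ (heightsBetween-head between)
  d = h ∸ cur
  d≤j : d ≤ j
  d≤j = ≮⇒≥ j≮d
  shift : cur + j ≡ h + (j ∸ d)
  shift = begin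
    cur + j              ≡⟨ cong (cur +_) (m+[n∸m]≡n d≤j) ⟨
    cur + (d + (j ∸ d))  ≡⟨ +-assoc cur d (j ∸ d) ⟨
    cur + d + (j ∸ d)    ≡⟨ cong (_+ (j ∸ d)) (m+[n∸m]≡n cur≤h) ⟩
    h + (j ∸ d)          ∎
  j′< : j ∸ d < top ∸ h
  j′< = +-cancelˡ-< d (j ∸ d) (top ∸ h)
    (subst₂ _<_ (sym (m+[n∸m]≡n d≤j)) (sym (∸-telescope cur≤h (proj₂ (heightsBetween-head between)))) j<)
  below⇔′ : ∀ t → t < length hs → nth hs t ≤ h + (j ∸ d) ⇔ t < c′
  below⇔′ t t< = mk⇔
    (λ ≤h+ → s<s⁻¹ (to (below⇔ (suc t) (s<s t<)) (subst (nth hs t ≤_) (sym shift) ≤h+)))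
    (λ t<c′ → subst (nth hs t ≤_) shift (from (below⇔ (suc t) (s<s t<)) (s<s t<c′)))

-- ⌈(u ∸ r) / b⌉, the number of positions of the form j * b + r below u.
colIndex : (b : ℕ) .{{_ : NonZero b}} → ℕ → ℕ → ℕ
colIndex b r u = (u + (b ∸ suc r)) / b

-- Column r (counting from 0) of a word read in rows of length b;
-- `strided b K w (suc r)` unfolds to `column b r K w`.
column : ℕ → ℕ → ℕ → List ℕ → List ℕ
column b r K w = map (λ j → nth w (j * b + r)) (upTo K)

length-column : ∀ b r K w → length (column b r K w) ≡ K
length-column b r K w = length-map-upTo _ K

nth-column : ∀ b r K w j → j < K → nth (column b r K w) j ≡ nth w (j * b + r)
nth-column b r K w = nth-map-upTo _ K

module _ (b : ℕ) .{{_ : NonZero b}} (r : ℕ) (r<b : r < b) where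

  private
    suc-j*b : ∀ j → suc j * b ≡ (j * b + suc r) + (b ∸ suc r)
    suc-j*b j = begin
      suc j * b                        ≡⟨ +-comm b (j * b) ⟩
      j * b + b                        ≡⟨ cong (j * b +_) (m+[n∸m]≡n r<b) ⟨
      j * b + (suc r + (b ∸ suc r))    ≡⟨ +-assoc (j * b) (suc r) _ ⟨
      (j * b + suc r) + (b ∸ suc r)    ∎
      where open ≡-Reasoning

  <colIndex⇒ : ∀ {u j} → j < colIndex b r u → j * b + r < u
  <colIndex⇒ {u} {j} j< = +-cancelʳ-≤ (b ∸ suc r) _ u (begin
    suc (j * b + r) + (b ∸ suc r)  ≡⟨ cong (_+ (b ∸ suc r)) (+-suc (j * b) r) ⟨
    (j * b + suc r) + (b ∸ suc r)  ≡⟨ suc-j*b j ⟨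
    suc j * b                      ≤⟨ *-monoˡ-≤ b j< ⟩
    colIndex b r u * b             ≤⟨ m/n*n≤m (u + (b ∸ suc r)) b ⟩
    u + (b ∸ suc r)                ∎)
    where open ≤-Reasoning

  <colIndex⇐ : ∀ {u j} → j * b + r < u → j < colIndex b r u
  <colIndex⇐ {u} {j} <u = begin
    suc j                          ≡⟨ m*n/n≡m (suc j) b ⟨
    suc j * b / b                  ≤⟨ /-monoˡ-≤ b (begin
      suc j * b                      ≡⟨ suc-j*b j ⟩
      (j * b + suc r) + (b ∸ suc r)  ≤⟨ +-monoˡ-≤ (b ∸ suc r) (≤-trans (≤-reflexive (+-suc (j * b) r)) <u) ⟩
      u + (b ∸ suc r)                ∎) ⟩
    colIndex b r u                 ∎
    where open ≤-Reasoning

  colIndex-≤ : ∀ {u K} → u ≤ b * K → colIndex b r u ≤ K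
  colIndex-≤ {u} {K} u≤ = ≮⇒≥ λ K< → <⇒≱ (<colIndex⇒ K<) (begin
    u          ≤⟨ u≤ ⟩
    b * K      ≡⟨ *-comm b K ⟩
    K * b      ≤⟨ m≤m+n (K * b) r ⟩
    K * b + r  ∎)
    where open ≤-Reasoning

  colIndex-lower : ∀ u → u ≤ colIndex b r u * b + r
  colIndex-lower u = ≮⇒≥ λ < → <-irrefl refl (<colIndex⇐ <)

  colIndex-upper : ∀ u → colIndex b r u * b + r < u + b
  colIndex-upper u with colIndex b r u in eq
  ... | zero  = ≤-trans r<b (m≤n+m b u)
  ... | suc c = begin-strict
    suc c * b + r    ≡⟨ +-assoc b (c * b) r ⟩
    b + (c * b + r)  <⟨ +-monoʳ-< b (<colIndex⇒ (subst (c <_) (sym eq) ≤-refl)) ⟩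
    b + u            ≡⟨ +-comm b u ⟩
    u + b            ∎
    where open ≤-Reasoning

  column-insertAt : ∀ K ws u k → length ws ≡ b * K → u ≤ b * K →
    column b r (suc K) (insertAt u (replicate b k) ws) ≡ insertAt (colIndex b r u) (k ∷ []) (column b r K ws)
  column-insertAt K ws u k len u≤ = nth-ext _ _ same-length pointwise
    where
    open ≤-Reasoning
    c = colIndex b r u
    col = column b r K ws
    ws' = insertAt u (replicate b k) ws
    col' = insertAt c (k ∷ []) col

    c≤K : c ≤ K
    c≤K = colIndex-≤ u≤
    c≤len : c ≤ length col
    c≤len = ≤-trans c≤K (≤-reflexive (sym (length-column b r K ws)))
    u≤len : u ≤ length ws
    u≤len = ≤-trans u≤ (≤-reflexive (sym len))

    same-length : length (column b r (suc K) ws') ≡ length col'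
    same-length = trans (length-column b r (suc K) ws')
      (sym (trans (length-insertAt c (k ∷ []) col) (cong suc (length-column b r K ws))))

    before : ∀ j → j < c → nth ws' (j * b + r) ≡ nth col' j
    before j j<c = begin-equality
      nth ws' (j * b + r)  ≡⟨ nth-insertAt-before u _ ws _ u≤len (<colIndex⇒ j<c) ⟩
      nth ws (j * b + r)   ≡⟨ nth-column b r K ws j (<-≤-trans j<c c≤K) ⟨
      nth col j            ≡⟨ nth-insertAt-before c _ col j c≤len j<c ⟨
      nth col' j           ∎

    at : nth ws' (c * b + r) ≡ nth col' c
    at = begin-equality
      nth ws' (c * b + r)                    ≡⟨ nth-insertAt-inside u _ ws _ u≤len (colIndex-lower u) inside ⟩
      nth (replicate b k) (c * b + r ∸ u)    ≡⟨ nth-replicate b k _ offset<b ⟩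
      k                                      ≡⟨ cong (nth (k ∷ [])) (n∸n≡0 c) ⟨
      nth (k ∷ []) (c ∸ c)                   ≡⟨ nth-insertAt-inside c _ col c c≤len ≤-refl (m<m+n c z<s) ⟨
      nth col' c                             ∎
      where
      inside : c * b + r < u + length (replicate b k)
      inside = subst (λ m → c * b + r < u + m) (sym (length-replicate b)) (colIndex-upper u)
      offset<b : c * b + r ∸ u < b
      offset<b = +-cancelˡ-< u _ _ (begin-strict
        u + (c * b + r ∸ u)  ≡⟨ m+[n∸m]≡n (colIndex-lower u) ⟩
        c * b + r            <⟨ colIndex-upper u ⟩
        u + b                ∎)

    after : ∀ j → c ≤ j → j < K → nth ws' (suc j * b + r) ≡ nth col' (suc j)
    after j c≤j j<K = begin-equality
      nth ws' (suc j * b + r)                           ≡⟨ nth-insertAt-after u _ ws _ u≤len past ⟩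
      nth ws (suc j * b + r ∸ length (replicate b k))   ≡⟨ cong (nth ws) shift ⟩
      nth ws (j * b + r)                                ≡⟨ nth-column b r K ws j j<K ⟨
      nth col j                                         ≡⟨ nth-insertAt-after c _ col (suc j) c≤len (≤-trans (≤-reflexive (+-comm c 1)) (s≤s c≤j)) ⟨
      nth col' (suc j)                                  ∎
      where
      past : u + length (replicate b k) ≤ suc j * b + r
      past = begin
        u + length (replicate b k)  ≡⟨ cong (u +_) (length-replicate b) ⟩
        u + b                       ≤⟨ +-monoˡ-≤ b (≤-trans (colIndex-lower u) (+-monoˡ-≤ r (*-monoˡ-≤ b c≤j))) ⟩
        j * b + r + b               ≡⟨ trans (+-comm (j * b + r) b) (sym (+-assoc b (j * b) r)) ⟩
        suc j * b + r               ∎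
      shift : suc j * b + r ∸ length (replicate b k) ≡ j * b + r
      shift = trans (cong₂ _∸_ (+-assoc b (j * b) r) (length-replicate b)) (m+n∸m≡n b (j * b + r))

    entry : ∀ j → j < suc K → nth ws' (j * b + r) ≡ nth col' j
    entry j _ with <-cmp j c
    ... | tri< j<c _ _ = before j j<c
    ... | tri≈ _ refl _ = at
    entry (suc j) (s≤s j<K) | tri> _ _ (s≤s c≤j) = after j c≤j j<K

    pointwise : ∀ j → j < length (column b r (suc K) ws') → nth (column b r (suc K) ws') j ≡ nth col' j
    pointwise j j< = trans (nth-column b r (suc K) ws' j j<K) (entry j j<K)
      where
      j<K : j < suc K
      j<K = subst (j <_) (length-column b r (suc K) ws') j<

  admissible-colIndex : ∀ K us → Admissible b K us → Admissible 1 K (map (colIndex b r) us)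
  admissible-colIndex K []       _           = tt
  admissible-colIndex K (u ∷ us) (u≤ , adm) =
    ≤-trans (colIndex-≤ u≤) (≤-reflexive (sym (*-identityˡ K))) , admissible-colIndex (suc K) us adm

  column-muGo : ∀ K ws us → length ws ≡ b * K → Admissible b K us →
    column b r (K + length us) (muGo b (suc K) ws us) ≡ muGo 1 (suc K) (column b r K ws) (map (colIndex b r) us)
  column-muGo K ws []       _   _           = cong (λ m → column b r m ws) (+-identityʳ K)
  column-muGo K ws (u ∷ us) len (u≤ , adm) = begin
    column b r (K + suc (length us)) (muGo b (suc (suc K)) ws' us)
      ≡⟨ cong (λ m → column b r m (muGo b (suc (suc K)) ws' us)) (+-suc K (length us)) ⟩
    column b r (suc K + length us) (muGo b (suc (suc K)) ws' us)
      ≡⟨ column-muGo (suc K) ws' us len' adm ⟩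
    muGo 1 (suc (suc K)) (column b r (suc K) ws') (map (colIndex b r) us)
      ≡⟨ cong (λ v → muGo 1 (suc (suc K)) v (map (colIndex b r) us)) (column-insertAt K ws u (suc K) len u≤) ⟩
    muGo 1 (suc (suc K)) (insertAt (colIndex b r u) (suc K ∷ []) (column b r K ws)) (map (colIndex b r) us)
      ∎
    where
    open ≡-Reasoning
    ws' = insertAt u (replicate b (suc K)) ws
    len' : length ws' ≡ b * suc K
    len' = trans (length-insertAt u _ ws) (trans (cong₂ _+_ (length-replicate b) len) (sym (*-suc b K)))

  column-mu : ∀ us → Admissible b 0 us → column b r (length us) (mu b us) ≡ mu 1 (map (colIndex b r) us)
  column-mu []       _          = refl
  column-mu (_ ∷ us) (_ , adm) = begin
    column b r (suc (length us)) (muGo b 2 (replicate b 1) us)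
      ≡⟨ column-muGo 1 (replicate b 1) us (trans (length-replicate b) (sym (*-identityʳ b))) adm ⟩
    muGo 1 2 (nth (replicate b 1) r ∷ []) (map (colIndex b r) us)
      ≡⟨ cong (λ x → muGo 1 2 (x ∷ []) (map (colIndex b r) us)) (nth-replicate b 1 r r<b) ⟩
    muGo 1 2 (1 ∷ []) (map (colIndex b r) us)
      ∎
    where open ≡-Reasoning

  stepSeq-fromHeights-column : ∀ n A P → countE P ≡ b * n → countN P ≡ A →
    stepSeq (fromHeights A (column b r n (heightSeq P))) ≡ map (colIndex b r) (stepSeq P)
  stepSeq-fromHeights-column n A P #E #N = nth-ext _ _ same-length pointwise
    where
    hs = heightSeq P
    us = stepSeq P
    S = column b r n hs

    position< : ∀ {t} → t < n → t * b + r < countE P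
    position< {t} t<n = begin-strict
      t * b + r  <⟨ +-monoʳ-< (t * b) r<b ⟩
      t * b + b  ≡⟨ +-comm (t * b) b ⟩
      suc t * b  ≤⟨ *-monoˡ-≤ b t<n ⟩
      n * b      ≡⟨ *-comm n b ⟩
      b * n      ≡⟨ #E ⟨
      countE P   ∎
      where open ≤-Reasoning

    t<n : ∀ {t} → t < length S → t < n
    t<n {t} = subst (t <_) (length-column b r n hs)

    nth-S : ∀ {t} → t < length S → nth S t ≡ nth hs (t * b + r)
    nth-S t< = nth-column b r n hs _ (t<n t<)

    between : HeightsBetween 0 A S
    between =
      (λ {m} {m′} m≤m′ m′< → subst₂ _≤_ (sym (nth-S (≤-<-trans m≤m′ m′<))) (sym (nth-S m′<))
         (heightSeqFrom-mono 0 P (+-monoˡ-≤ r (*-monoˡ-≤ b m≤m′)) (position< (t<n m′<)))) ,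
      (λ t t< → z≤n , subst₂ _≤_ (sym (nth-S t<)) #N (heightSeqFrom-≤ 0 P _ (position< (t<n t<))))

    length-path : countN (fromHeights A S) ≡ A
    length-path = countN-fromHeightsFrom A 0 S between

    same-length : length (stepSeq (fromHeights A S)) ≡ length (map (colIndex b r) us)
    same-length = trans (length-stepSeqFrom 0 (fromHeights A S)) (trans length-path
      (sym (trans (length-map _ us) (trans (length-stepSeqFrom 0 P) #N))))

    pointwise : ∀ j → j < length (stepSeq (fromHeights A S)) →
      nth (stepSeq (fromHeights A S)) j ≡ nth (map (colIndex b r) us) j
    pointwise j j< = begin
      nth (stepSeq (fromHeights A S)) j  ≡⟨ nth-stepSeq-fromHeightsFrom A 0 0 S j _ between j<A c≤n below⇔ ⟩
      colIndex b r (nth us j)            ≡⟨ nth-map (colIndex b r) us j (subst (j <_) (sym (length-stepSeqFrom 0 P)) j<#N) ⟨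
      nth (map (colIndex b r) us) j      ∎
      where
      open ≡-Reasoning
      j<A : j < A
      j<A = subst (j <_) (trans (length-stepSeqFrom 0 (fromHeights A S)) length-path) j<
      j<#N : j < countN P
      j<#N = subst (j <_) (sym #N) j<A
      c≤n : colIndex b r (nth us j) ≤ length S
      c≤n = ≤-trans (colIndex-≤ (subst (nth us j ≤_) #E (stepSeqFrom-≤ 0 P j j<#N)))
                    (≤-reflexive (sym (length-column b r n hs)))
      below⇔ : ∀ t → t < length S → nth S t ≤ j ⇔ t < colIndex b r (nth us j)
      below⇔ t t< = mk⇔
        (λ ≤j → <colIndex⇐ (to east-before-north (subst (_≤ j) (nth-S t<) ≤j)))
        (λ t<c → subst (_≤ j) (sym (nth-S t<)) (from east-before-north (<colIndex⇒ t<c)))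
        where
        east-before-north = heightSeq-≤⇔-stepSeq-> 0 0 P (t * b + r) j (position< (t<n t<)) j<#N

mainTheorem6 : (a b n : ℕ) → 0 < a → 0 < b → Coprime a b → 1 ≤ n →
    (P : List Step) → IsDyck a b n P →
    (i : ℕ) → 1 ≤ i → i ≤ b →
    muInv1 (strided b (a * n) (mu b (stepSeq P)) i) ≡ stepSeq (hStrip a b n P i)
mainTheorem6 a b@(suc _) n 0<a _ _ _ P (#E , #N , dyck) (suc r) _ r<b = begin
  muInv1 (column b r (a * n) (mu b us))          ≡⟨ cong (λ K → muInv1 (column b r K (mu b us))) length-us ⟨
  muInv1 (column b r (length us) (mu b us))      ≡⟨ cong muInv1 (column-mu b r r<b us admissible) ⟩
  muInv1 (mu 1 (map (colIndex b r) us))          ≡⟨ muInv1-mu₁ _ (admissible-colIndex b r r<b 0 us admissible) ⟩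
  map (colIndex b r) us                          ≡⟨ stepSeq-fromHeights-column b r r<b n (a * n) P #E #N ⟨
  stepSeq (fromHeights (a * n) (column b r n (heightSeq P))) ∎
  where
  open ≡-Reasoning
  us = stepSeq P
  length-us : length us ≡ a * n
  length-us = trans (length-stepSeqFrom 0 P) #N
  admissible : Admissible b 0 us
  admissible = admissible-stepSeqFrom a b {{>-nonZero 0<a}} 0 0 P dyck
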